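{- Let $\vec b=(b_0,b_1,\dots)$ be an infinite sequence of integers and let $n\ge2$. Then $\widehat{C}^{\vec b}_{3,4,n}=(b_0+3b_2)\,\widehat{C}^{\vec b}_{3,4,n-1}+b_0b_2\,\widehat{C}^{\vec b}_{3,4,n-2}$.
   Context: A $k$-dimensional balanced ballot path of length $kn$ is a sequence of $kn$ standard unit vectors of $\mathbb{R}^k$, each $\vec e_i$ occurring exactly $n$ times, such that every intermediate point (partial sum, including the origin) $\vec x=(x_1,\dots,x_k)$ satisfies $x_1\ge\cdots\ge x_k$. The semisymmetric height of $\vec x$ is $g_k(\vec x)=\sum_{i=1}^k(k+1-2i)x_i$ (so $g_3(\vec x)=2x_1-2x_3$) and the semisymmetric height $g_k(P)$ of a path is the maximum of $g_k$ over its intermediate points (the empty path has height $0$). Steps $\vec e_i$ with $i\le\lfloor k/2\rfloor$ are semisymmetric up-steps. For a sequence $\vec b$, the weight $sswt_{\vec b}(P)$ is the product, over all up-steps of $P$, of $b_h$ where $h$ is the semisymmetric height of the starting point of that up-step (the empty path has weight $1$). Define $\widehat{C}^{\vec b}_{k,u,n}=\sum_P sswt_{\vec b}(P)$, summed over all $k$-dimensional balanced ballot paths of length $kn$ with $g_k(P)\le u$. -}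

module Defs where

open import Data.Nat as ℕ using (ℕ; zero; suc; _/_)
open import Data.Nat.Properties using (_≤?_)
open import Data.Integer as ℤ using (ℤ; +_; _-_; _*_; _+_; ∣_∣; _⊔_)
import Data.Integer.Properties as ℤP
open import Data.Fin using (Fin; toℕ)
open import Data.Vec as V using (Vec; replicate; updateAt; toList)
open import Data.List as L using (List; []; _∷_; allFin; concatMap; map; filterᵇ; foldr)
open import Data.Bool using (Bool; true; false; _∧_)
open import Relation.Nullary.Decidable using (⌊_⌋)

allᵇ : ∀ {A : Set} → (A → Bool) → List A → Bool
allᵇ p = foldr (λ a r → p a ∧ r) true

sumℤ : List ℤ → ℤ
sumℤ = foldr _+_ (+ 0)

Point : ℕ → Set
Point k = Vec ℕ k

origin : ∀ {k} → Point k
origin = replicate _ 0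

step : ∀ {k} → Point k → Fin k → Point k
step x j = updateAt x j suc

words : (k m : ℕ) → List (List (Fin k))
words k zero    = [] ∷ []
words k (suc m) = concatMap (λ w → map (_∷ w) (allFin k)) (words k m)

pointsFrom : ∀ {k} → Point k → List (Fin k) → List (Point k)
pointsFrom x []      = x ∷ []
pointsFrom x (s ∷ w) = x ∷ pointsFrom (step x s) w

points : ∀ {k} → List (Fin k) → List (Point k)
points = pointsFrom origin

endpoint : ∀ {k} → List (Fin k) → Point k
endpoint = L.foldl step origin

decreasing : List ℕ → Bool
decreasing []           = true
decreasing (a ∷ [])     = true
decreasing (a ∷ b ∷ xs) = ⌊ b ≤? a ⌋ ∧ decreasing (b ∷ xs)

allEq : ℕ → List ℕ → Bool
allEq n = allᵇ (λ a → ⌊ a ℕ.≟ n ⌋)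

-- Balanced ballot path of length k·n: each e_i occurs n times (endpoint (n,…,n))
-- and every intermediate point satisfies x₁ ≥ ⋯ ≥ x_k.
isBalancedBallot : ∀ {k} → ℕ → List (Fin k) → Bool
isBalancedBallot n w =
  allEq n (toList (endpoint w)) ∧ allᵇ (λ x → decreasing (toList x)) (points w)

-- Semisymmetric height g_k(x) = Σ_{i=1}^k (k+1-2i) x_i.  With 0-based index j = i-1
-- the coefficient is k - 1 - 2j.
coeff : (k : ℕ) → Fin k → ℤ
coeff k j = + k - + 1 - + (2 ℕ.* toℕ j)

g : ∀ {k} → Point k → ℤ
g {k} x = sumℤ (L.zipWith (λ j xj → coeff k j * + xj) (allFin k) (toList x))

-- Semisymmetric height of a path: maximum of g_k over its intermediate points
-- (the list of points always contains the origin, where g_k = 0).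
height : ∀ {k} → List (Fin k) → ℤ
height {k} w = foldr (λ x m → g x ⊔ m) (+ 0) (points w)

-- Up-step: e_i with i ≤ ⌊k/2⌋, i.e. 0-based index j with j+1 ≤ k/2.
isUp : (k : ℕ) → Fin k → Bool
isUp k j = ⌊ suc (toℕ j) ≤? k / 2 ⌋

-- Weight: product over up-steps of b_h, h = semisymmetric height of the starting point.
-- (On ballot paths h ≥ 0; we index b by ∣h∣.)
wtFrom : ∀ {k} → (ℕ → ℤ) → Point k → List (Fin k) → ℤ
wtFrom b x []      = + 1
wtFrom {k} b x (s ∷ w) with isUp k s
... | true  = b ∣ g x ∣ * wtFrom b (step x s) w
... | false = wtFrom b (step x s) w

sswt : ∀ {k} → (ℕ → ℤ) → List (Fin k) → ℤ
sswt b = wtFrom b origin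

Chat : (b : ℕ → ℤ) (k u n : ℕ) → ℤ
Chat b k u n =
  sumℤ (map (sswt b)
    (filterᵇ (λ w → isBalancedBallot n w ∧ ⌊ height w ℤ.≤? + u ⌋) (words k (k ℕ.* n))))

{-# OPTIONS --safe #-}
-- Up to translation along (1, 1, 1), the points with x₁ ≥ x₂ ≥ x₃ and g₃ = 2(x₁ − x₃) ≤ 4
-- are the six points (i, j, 0) with 2 ≥ i ≥ j ≥ 0, so a path counted by Ĉ_{3,4,n} is a walk
-- in a six-state automaton and Ĉ_{3,4,n} = (T³ⁿ δ)(s00) for its transfer operator T.
-- With x = b₀ and y = b₂, three steps of T send the values of f at s00 and s21 to
-- x f(s00) + 2xy f(s21) and 2 f(s00) + 3y f(s21). This 2 × 2 matrix has trace x + 3y and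
-- determinant −xy, so Cayley–Hamilton gives the recurrence.

module Submission where

open import Defs
open import Data.Nat using (ℕ; _≥_)
open import Data.Integer using (ℤ; _+_; _*_; +_)
open import Relation.Binary.PropositionalEquality using (_≡_)

open import Data.Nat as ℕ using (zero; suc; _<_; _≤_; z≤n; s≤s)
import Data.Nat.Properties as ℕP
open import Data.Integer as ℤ using (+0; -[1+_]; _-_; ∣_∣; _⊔_; +≤+)
open import Data.Integer.Properties as ℤP using (*-identityˡ; *-zeroʳ; +-identityʳ)
open import Data.Fin using (Fin; zero; suc)
open import Data.Vec as V using (_∷_; []; toList)
open import Data.List as L using (List; []; _∷_; map; foldr; filterᵇ; _++_; concatMap; allFin)
import Data.List.Properties as LP
open import Data.Bool using (Bool; true; false; _∧_; if_then_else_)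
open import Data.Bool.Properties using (∧-assoc; ∧-comm; ∧-zeroʳ; ∧-identityʳ; ∧-commutativeMonoid)
open import Algebra.Bundles using (CommutativeMonoid)
open import Algebra.Properties.CommutativeSemigroup (CommutativeMonoid.commutativeSemigroup ∧-commutativeMonoid) using () renaming (interchange to ∧-interchange)
open import Algebra.Properties.CommutativeSemigroup ℤP.+-commutativeSemigroup using () renaming (interchange to +-interchange)
open import Data.Maybe using (Maybe; just; nothing)
open import Data.Product using (_,_; ∃-syntax)
open import Data.Empty using (⊥-elim)
open import Function using (_∘_)
open import Relation.Nullary using (¬_; Dec; yes; no)
open import Relation.Nullary.Decidable using (⌊_⌋; isYes≗does; dec-true; dec-false)
open import Relation.Binary.PropositionalEquality using (_≢_; refl; sym; trans; cong; cong₂; module ≡-Reasoning)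
open import Data.Integer.Tactic.RingSolver using (solve-∀)

open ≡-Reasoning

⌊⌋-true : ∀ {P : Set} (P? : Dec P) → P → ⌊ P? ⌋ ≡ true
⌊⌋-true P? p = trans (isYes≗does P?) (dec-true P? p)

⌊⌋-false : ∀ {P : Set} (P? : Dec P) → ¬ P → ⌊ P? ⌋ ≡ false
⌊⌋-false P? ¬p = trans (isYes≗does P?) (dec-false P? ¬p)

private variable
  A B : Set

sumℤ-map-cong : ∀ {f h : A → ℤ} → (∀ a → f a ≡ h a) → ∀ xs → sumℤ (map f xs) ≡ sumℤ (map h xs)
sumℤ-map-cong f≗h xs = cong sumℤ (LP.map-cong f≗h xs)

sumℤ-map-zero : ∀ {f : A → ℤ} → (∀ a → f a ≡ +0) → ∀ xs → sumℤ (map f xs) ≡ +0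
sumℤ-map-zero f≗0 []       = refl
sumℤ-map-zero f≗0 (a ∷ xs) = trans (cong₂ _+_ (f≗0 a) (sumℤ-map-zero f≗0 xs)) (ℤP.+-identityˡ +0)

sumℤ-map-+ : ∀ (f h : A → ℤ) xs → sumℤ (map (λ a → f a + h a) xs) ≡ sumℤ (map f xs) + sumℤ (map h xs)
sumℤ-map-+ f h []       = refl
sumℤ-map-+ f h (a ∷ xs) = trans (cong (_+_ (f a + h a)) (sumℤ-map-+ f h xs)) (+-interchange (f a) (h a) _ _)

sumℤ-map-*ˡ : ∀ c (f : A → ℤ) xs → sumℤ (map (λ a → c * f a) xs) ≡ c * sumℤ (map f xs)
sumℤ-map-*ˡ c f []       = sym (*-zeroʳ c)
sumℤ-map-*ˡ c f (a ∷ xs) = trans (cong (_+_ (c * f a)) (sumℤ-map-*ˡ c f xs)) (sym (ℤP.*-distribˡ-+ c (f a) _))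

sumℤ-++ : ∀ (xs ys : List ℤ) → sumℤ (xs ++ ys) ≡ sumℤ xs + sumℤ ys
sumℤ-++ []       ys = sym (ℤP.+-identityˡ _)
sumℤ-++ (x ∷ xs) ys = trans (cong (_+_ x) (sumℤ-++ xs ys)) (sym (ℤP.+-assoc x _ _))

sumℤ-filterᵇ : ∀ (P : A → Bool) (f : A → ℤ) xs →
  sumℤ (map f (filterᵇ P xs)) ≡ sumℤ (map (λ a → if P a then f a else +0) xs)
sumℤ-filterᵇ P f []       = refl
sumℤ-filterᵇ P f (a ∷ xs) with P a
... | true  = cong (_+_ (f a)) (sumℤ-filterᵇ P f xs)
... | false = trans (sumℤ-filterᵇ P f xs) (sym (ℤP.+-identityˡ _))

sumℤ-concatMap : ∀ (F : A → List B) (h : B → ℤ) xs →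
  sumℤ (map h (concatMap F xs)) ≡ sumℤ (map (λ a → sumℤ (map h (F a))) xs)
sumℤ-concatMap F h []       = refl
sumℤ-concatMap F h (a ∷ xs) = begin
  sumℤ (map h (F a ++ concatMap F xs))
    ≡⟨ cong sumℤ (LP.map-++ h (F a) _) ⟩
  sumℤ (map h (F a) ++ map h (concatMap F xs))
    ≡⟨ sumℤ-++ (map h (F a)) _ ⟩
  sumℤ (map h (F a)) + sumℤ (map h (concatMap F xs))
    ≡⟨ cong (_+_ (sumℤ (map h (F a)))) (sumℤ-concatMap F h xs) ⟩
  sumℤ (map h (F a)) + sumℤ (map (λ a → sumℤ (map h (F a))) xs) ∎

sumℤ-map-comm : ∀ (F : A → B → ℤ) xs ys →
  sumℤ (map (λ a → sumℤ (map (F a) ys)) xs) ≡ sumℤ (map (λ c → sumℤ (map (λ a → F a c) xs)) ys)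
sumℤ-map-comm F []       ys = sym (sumℤ-map-zero (λ _ → refl) ys)
sumℤ-map-comm F (a ∷ xs) ys = begin
  sumℤ (map (F a) ys) + sumℤ (map (λ a → sumℤ (map (F a) ys)) xs)
    ≡⟨ cong (_+_ (sumℤ (map (F a) ys))) (sumℤ-map-comm F xs ys) ⟩
  sumℤ (map (F a) ys) + sumℤ (map (λ c → sumℤ (map (λ a → F a c) xs)) ys)
    ≡⟨ sym (sumℤ-map-+ (F a) _ ys) ⟩
  sumℤ (map (λ c → F a c + sumℤ (map (λ a → F a c) xs)) ys) ∎

allᵇ-∧ : ∀ (p q : A → Bool) xs → allᵇ (λ a → p a ∧ q a) xs ≡ allᵇ p xs ∧ allᵇ q xs
allᵇ-∧ p q []       = refl
allᵇ-∧ p q (a ∷ xs) = trans (cong (_∧_ (p a ∧ q a)) (allᵇ-∧ p q xs)) (∧-interchange (p a) (q a) _ _)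

⊔-≤? : ∀ i j k → ⌊ i ⊔ j ℤ.≤? k ⌋ ≡ ⌊ i ℤ.≤? k ⌋ ∧ ⌊ j ℤ.≤? k ⌋
⊔-≤? i j k with i ℤ.≤? k | j ℤ.≤? k
... | yes i≤k | yes j≤k = ⌊⌋-true (i ⊔ j ℤ.≤? k) (ℤP.⊔-lub i≤k j≤k)
... | yes _   | no j≰k  = ⌊⌋-false (i ⊔ j ℤ.≤? k) (j≰k ∘ ℤP.i⊔j≤k⇒j≤k i j)
... | no i≰k  | _       = ⌊⌋-false (i ⊔ j ℤ.≤? k) (i≰k ∘ ℤP.i⊔j≤k⇒i≤k i j)

foldr-⊔-≤? : ∀ (f : A → ℤ) u xs →
  ⌊ foldr (λ a m → f a ⊔ m) (+ 0) xs ℤ.≤? + u ⌋ ≡ allᵇ (λ a → ⌊ f a ℤ.≤? + u ⌋) xs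
foldr-⊔-≤? f u []       = ⌊⌋-true (+ 0 ℤ.≤? + u) (+≤+ z≤n)
foldr-⊔-≤? f u (a ∷ xs) = trans (⊔-≤? (f a) _ (+ u)) (cong (⌊ f a ℤ.≤? + u ⌋ ∧_) (foldr-⊔-≤? f u xs))

-- Weighted path sums in dimension k

admissible : ∀ {k} → ℕ → Point k → Bool
admissible u x = decreasing (toList x) ∧ ⌊ g x ℤ.≤? + u ⌋

upWeight : ∀ {k} → (ℕ → ℤ) → Point k → Fin k → ℤ
upWeight {k} b x s = if isUp k s then b ∣ g x ∣ else + 1

wtFrom-∷ : ∀ {k} b (x : Point k) s w → wtFrom b x (s ∷ w) ≡ upWeight b x s * wtFrom b (step x s) w
wtFrom-∷ {k} b x s w with isUp k s
... | true  = refl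
... | false = sym (*-identityˡ _)

sum-step : ∀ {k} (x : Point k) j → V.sum (step x j) ≡ suc (V.sum x)
sum-step (_ ∷ _)  zero    = refl
sum-step (a ∷ xs) (suc j) = trans (cong (a ℕ.+_) (sum-step xs j)) (ℕP.+-suc a _)

sumℤ-words-suc : ∀ k m (h : List (Fin k) → ℤ) →
  sumℤ (map h (words k (suc m))) ≡ sumℤ (map (λ s → sumℤ (map (λ w → h (s ∷ w)) (words k m))) (allFin k))
sumℤ-words-suc k m h = begin
  sumℤ (map h (concatMap (λ w → map (_∷ w) (allFin k)) (words k m)))
    ≡⟨ sumℤ-concatMap _ h (words k m) ⟩
  sumℤ (map (λ w → sumℤ (map h (map (_∷ w) (allFin k)))) (words k m))
    ≡⟨ sumℤ-map-cong (λ w → cong sumℤ (sym (LP.map-∘ (allFin k)))) (words k m) ⟩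
  sumℤ (map (λ w → sumℤ (map (λ s → h (s ∷ w)) (allFin k))) (words k m))
    ≡⟨ sumℤ-map-comm (λ w s → h (s ∷ w)) (words k m) (allFin k) ⟩
  sumℤ (map (λ s → sumℤ (map (λ w → h (s ∷ w)) (words k m))) (allFin k)) ∎

module PathSum (b : ℕ → ℤ) (k u n : ℕ) where

  pathSum : Point k → ℕ → ℤ
  pathSum x zero    = if admissible u x ∧ allEq n (toList x) then + 1 else +0
  pathSum x (suc m) =
    if admissible u x then sumℤ (map (λ s → upWeight b x s * pathSum (step x s) m) (allFin k)) else +0

  pathSum-inadmissible : ∀ {x} m → admissible u x ≡ false → pathSum x m ≡ +0
  pathSum-inadmissible zero    eq rewrite eq = refl
  pathSum-inadmissible (suc m) eq rewrite eq = refl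

  pathSum-suc : ∀ {x} m → admissible u x ≡ true →
    pathSum x (suc m) ≡ sumℤ (map (λ s → upWeight b x s * pathSum (step x s) m) (allFin k))
  pathSum-suc m eq rewrite eq = refl

  admissiblePath : Point k → List (Fin k) → Bool
  admissiblePath x w = allᵇ (admissible u) (pointsFrom x w) ∧ allEq n (toList (L.foldl step x w))

  admissibleWeight : Point k → List (Fin k) → ℤ
  admissibleWeight x w = if admissiblePath x w then wtFrom b x w else +0

  admissibleWeight-∷ : ∀ {x} s w → admissible u x ≡ true → admissibleWeight x (s ∷ w) ≡ upWeight b x s * admissibleWeight (step x s) w
  admissibleWeight-∷ {x} s w eq rewrite eq with admissiblePath (step x s) w
  ... | true  = wtFrom-∷ b x s w
  ... | false = sym (*-zeroʳ (upWeight b x s))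

  admissibleWeight-∷-inadmissible : ∀ {x} s w → admissible u x ≡ false → admissibleWeight x (s ∷ w) ≡ +0
  admissibleWeight-∷-inadmissible s w eq rewrite eq = refl

  sum-admissibleWeight : ∀ x m → sumℤ (map (admissibleWeight x) (words k m)) ≡ pathSum x m
  sum-admissibleWeight x zero = begin
    admissibleWeight x [] + +0                                         ≡⟨ +-identityʳ _ ⟩
    (if (admissible u x ∧ true) ∧ allEq n (toList x) then + 1 else +0)
      ≡⟨ cong (λ c → if c ∧ allEq n (toList x) then + 1 else +0) (∧-identityʳ _) ⟩
    pathSum x zero                                             ∎
  sum-admissibleWeight x (suc m) = trans (sumℤ-words-suc k m (admissibleWeight x)) (by-admissibility (admissible u x) refl)
    where
    by-admissibility : ∀ c → admissible u x ≡ c →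
      sumℤ (map (λ s → sumℤ (map (λ w → admissibleWeight x (s ∷ w)) (words k m))) (allFin k)) ≡ pathSum x (suc m)
    by-admissibility true eq = begin
      sumℤ (map (λ s → sumℤ (map (λ w → admissibleWeight x (s ∷ w)) (words k m))) (allFin k))
        ≡⟨ sumℤ-map-cong (λ s → sumℤ-map-cong (λ w → admissibleWeight-∷ s w eq) (words k m)) (allFin k) ⟩
      sumℤ (map (λ s → sumℤ (map (λ w → upWeight b x s * admissibleWeight (step x s) w) (words k m))) (allFin k))
        ≡⟨ sumℤ-map-cong (λ s → sumℤ-map-*ˡ (upWeight b x s) _ (words k m)) (allFin k) ⟩
      sumℤ (map (λ s → upWeight b x s * sumℤ (map (admissibleWeight (step x s)) (words k m))) (allFin k))
        ≡⟨ sumℤ-map-cong (λ s → cong (upWeight b x s *_) (sum-admissibleWeight (step x s) m)) (allFin k) ⟩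
      sumℤ (map (λ s → upWeight b x s * pathSum (step x s) m) (allFin k))
        ≡⟨ sym (pathSum-suc m eq) ⟩
      pathSum x (suc m) ∎
    by-admissibility false eq = begin
      sumℤ (map (λ s → sumℤ (map (λ w → admissibleWeight x (s ∷ w)) (words k m))) (allFin k))
        ≡⟨ sumℤ-map-zero (λ s → sumℤ-map-zero (λ w → admissibleWeight-∷-inadmissible s w eq) (words k m)) (allFin k) ⟩
      +0
        ≡⟨ sym (pathSum-inadmissible (suc m) eq) ⟩
      pathSum x (suc m) ∎

  ballot≡admissiblePath : ∀ w → (isBalancedBallot n w ∧ ⌊ height w ℤ.≤? + u ⌋) ≡ admissiblePath origin w
  ballot≡admissiblePath w = begin
    (endsAtN ∧ allᵇ (decreasing ∘ toList) ps) ∧ ⌊ height w ℤ.≤? + u ⌋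
      ≡⟨ cong ((endsAtN ∧ allᵇ (decreasing ∘ toList) ps) ∧_) (foldr-⊔-≤? g u ps) ⟩
    (endsAtN ∧ allᵇ (decreasing ∘ toList) ps) ∧ allᵇ (λ x → ⌊ g x ℤ.≤? + u ⌋) ps
      ≡⟨ ∧-assoc endsAtN _ _ ⟩
    endsAtN ∧ (allᵇ (decreasing ∘ toList) ps ∧ allᵇ (λ x → ⌊ g x ℤ.≤? + u ⌋) ps)
      ≡⟨ ∧-comm endsAtN _ ⟩
    (allᵇ (decreasing ∘ toList) ps ∧ allᵇ (λ x → ⌊ g x ℤ.≤? + u ⌋) ps) ∧ endsAtN
      ≡⟨ cong (_∧ endsAtN) (sym (allᵇ-∧ (decreasing ∘ toList) _ ps)) ⟩
    admissiblePath origin w ∎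
    where
    ps : List (Point k)
    ps = points w
    endsAtN : Bool
    endsAtN = allEq n (toList (endpoint w))

  Chat≡pathSum : Chat b k u n ≡ pathSum origin (k ℕ.* n)
  Chat≡pathSum = begin
    Chat b k u n
      ≡⟨ sumℤ-filterᵇ _ (sswt b) (words k (k ℕ.* n)) ⟩
    sumℤ (map (λ w → if isBalancedBallot n w ∧ ⌊ height w ℤ.≤? + u ⌋ then sswt b w else +0) (words k (k ℕ.* n)))
      ≡⟨ sumℤ-map-cong (λ w → cong (if_then sswt b w else +0) (ballot≡admissiblePath w)) (words k (k ℕ.* n)) ⟩
    sumℤ (map (admissibleWeight origin) (words k (k ℕ.* n)))
      ≡⟨ sum-admissibleWeight origin (k ℕ.* n) ⟩
    pathSum origin (k ℕ.* n) ∎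

-- Dimension 3 and height at most 4

pattern e₁ = zero
pattern e₂ = suc zero
pattern e₃ = suc (suc zero)

-- sᵢⱼ stands for the points (i + t, j + t, t).
data Shape : Set where
  s00 s10 s11 s20 s21 s22 : Shape

top mid : Shape → ℕ
top s00 = 0
top s10 = 1
top s11 = 1
top s20 = 2
top s21 = 2
top s22 = 2
mid s00 = 0
mid s10 = 0
mid s11 = 1
mid s20 = 0
mid s21 = 1
mid s22 = 2

shape : Shape → ℕ → Point 3
shape s t = top s ℕ.+ t ∷ mid s ℕ.+ t ∷ t ∷ []

move : Shape → Fin 3 → Maybe Shape
move s00 e₁ = just s10
move s10 e₁ = just s20
move s10 e₂ = just s11
move s11 e₁ = just s21
move s11 e₃ = just s00
move s20 e₂ = just s21
move s21 e₂ = just s22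
move s21 e₃ = just s10
move s22 e₃ = just s11
move _   _  = nothing

-- x, y, z play the roles of b₀, b₂, b₄, the weights of up-steps from heights 0, 2, 4;
-- the up-steps from height 4 leave the strip, so z never contributes.
module Transfer (x y z : ℤ) where

  level : Shape → ℤ
  level s00 = x
  level s10 = y
  level s11 = y
  level _   = z

  weight : Shape → Fin 3 → ℤ
  weight s e₁ = level s
  weight s _  = + 1

  follow : (Shape → ℤ) → Maybe Shape → ℤ
  follow f (just s) = f s
  follow f nothing  = +0

  T : (Shape → ℤ) → Shape → ℤ
  T f s = sumℤ (map (λ σ → weight s σ * follow f (move s σ)) (allFin 3))

  E : ℕ → Shape → ℤ
  E zero s00 = + 1
  E zero _   = +0
  E (suc m)  = T (E m)

  T-s00 : ∀ f → T f s00 ≡ x * f s10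
  T-s00 f = +-identityʳ (x * f s10)

  T-s10 : ∀ f → T f s10 ≡ y * f s20 + f s11
  T-s10 f = tidy (y * f s20) (f s11)
    where
    tidy : ∀ p q → p + (+ 1 * q + +0) ≡ p + q
    tidy = solve-∀

  T-s11 : ∀ f → T f s11 ≡ y * f s21 + f s00
  T-s11 f = tidy (y * f s21) (f s00)
    where
    tidy : ∀ p q → p + (+0 + (+ 1 * q + +0)) ≡ p + q
    tidy = solve-∀

  T-s20 : ∀ f → T f s20 ≡ f s21
  T-s20 f = tidy z (f s21)
    where
    tidy : ∀ w q → w * +0 + (+ 1 * q + +0) ≡ q
    tidy = solve-∀

  T-s21 : ∀ f → T f s21 ≡ f s22 + f s10
  T-s21 f = tidy z (f s22) (f s10)
    where
    tidy : ∀ w p q → w * +0 + (+ 1 * p + (+ 1 * q + +0)) ≡ p + q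
    tidy = solve-∀

  T-s22 : ∀ f → T f s22 ≡ f s11
  T-s22 f = tidy z (f s11)
    where
    tidy : ∀ w q → w * +0 + (+0 + (+ 1 * q + +0)) ≡ q
    tidy = solve-∀

  T³-s00 : ∀ f → T (T (T f)) s00 ≡ x * f s00 + + 2 * x * y * f s21
  T³-s00 f = begin
    T (T (T f)) s00                              ≡⟨ T-s00 (T (T f)) ⟩
    x * T (T f) s10                              ≡⟨ cong (x *_) (T-s10 (T f)) ⟩
    x * (y * T f s20 + T f s11)                  ≡⟨ cong₂ (λ p q → x * (y * p + q)) (T-s20 f) (T-s11 f) ⟩
    x * (y * f s21 + (y * f s21 + f s00))        ≡⟨ collect x y (f s00) (f s21) ⟩
    x * f s00 + + 2 * x * y * f s21              ∎
    where
    collect : ∀ x y a c → x * (y * c + (y * c + a)) ≡ x * a + + 2 * x * y * c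
    collect = solve-∀

  T³-s21 : ∀ f → T (T (T f)) s21 ≡ + 2 * f s00 + + 3 * y * f s21
  T³-s21 f = begin
    T (T (T f)) s21                              ≡⟨ T-s21 (T (T f)) ⟩
    T (T f) s22 + T (T f) s10                    ≡⟨ cong₂ _+_ (T-s22 (T f)) (T-s10 (T f)) ⟩
    T f s11 + (y * T f s20 + T f s11)            ≡⟨ cong₂ (λ p q → q + (y * p + q)) (T-s20 f) (T-s11 f) ⟩
    (y * f s21 + f s00) + (y * f s21 + (y * f s21 + f s00)) ≡⟨ collect y (f s00) (f s21) ⟩
    + 2 * f s00 + + 3 * y * f s21                ∎
    where
    collect : ∀ y a c → (y * c + a) + (y * c + (y * c + a)) ≡ + 2 * a + + 3 * y * c
    collect = solve-∀

  cayley-hamilton : ∀ f → T (T (T (T (T (T f))))) s00 ≡ (x + + 3 * y) * T (T (T f)) s00 + x * y * f s00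
  cayley-hamilton f = begin
    T (T (T (T (T (T f))))) s00
      ≡⟨ T³-s00 (T (T (T f))) ⟩
    x * T (T (T f)) s00 + + 2 * x * y * T (T (T f)) s21
      ≡⟨ cong₂ (λ p q → x * p + + 2 * x * y * q) (T³-s00 f) (T³-s21 f) ⟩
    x * (x * a + + 2 * x * y * c) + + 2 * x * y * (+ 2 * a + + 3 * y * c)
      ≡⟨ characteristic x y a c ⟩
    (x + + 3 * y) * (x * a + + 2 * x * y * c) + x * y * a
      ≡⟨ cong (λ p → (x + + 3 * y) * p + x * y * a) (sym (T³-s00 f)) ⟩
    (x + + 3 * y) * T (T (T f)) s00 + x * y * a ∎
    where
    a c : ℤ
    a = f s00
    c = f s21
    characteristic : ∀ x y a c →
      x * (x * a + + 2 * x * y * c) + + 2 * x * y * (+ 2 * a + + 3 * y * c)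
        ≡ (x + + 3 * y) * (x * a + + 2 * x * y * c) + x * y * a
    characteristic = solve-∀

  E-recurrence : ∀ k →
    E (3 ℕ.* (2 ℕ.+ k)) s00 ≡ (x + + 3 * y) * E (3 ℕ.* (1 ℕ.+ k)) s00 + x * y * E (3 ℕ.* k) s00
  E-recurrence k = begin
    E (3 ℕ.* (2 ℕ.+ k)) s00
      ≡⟨ cong (λ m → E m s00) (trans (ℕP.*-suc 3 (1 ℕ.+ k)) (cong (3 ℕ.+_) (ℕP.*-suc 3 k))) ⟩
    T (T (T (T (T (T (E (3 ℕ.* k))))))) s00
      ≡⟨ cayley-hamilton (E (3 ℕ.* k)) ⟩
    (x + + 3 * y) * E (3 ℕ.+ 3 ℕ.* k) s00 + x * y * E (3 ℕ.* k) s00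
      ≡⟨ cong (λ m → (x + + 3 * y) * E m s00 + x * y * E (3 ℕ.* k) s00) (sym (ℕP.*-suc 3 k)) ⟩
    (x + + 3 * y) * E (3 ℕ.* (1 ℕ.+ k)) s00 + x * y * E (3 ℕ.* k) s00 ∎

g₃ : ∀ x₁ x₂ x₃ → g (x₁ ∷ x₂ ∷ x₃ ∷ []) ≡ + 2 * (+ x₁ - + x₃)
g₃ x₁ x₂ x₃ = unfolded (+ x₁) (+ x₂) (+ x₃)
  where
  unfolded : ∀ p q r → + 2 * p + (+ 0 * q + (-[1+ 1 ] * r + + 0)) ≡ + 2 * (p - r)
  unfolded = solve-∀

g-lift : ∀ a c t → g (a ℕ.+ t ∷ c ℕ.+ t ∷ t ∷ []) ≡ + (2 ℕ.* a)
g-lift a c t = begin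
  g (a ℕ.+ t ∷ c ℕ.+ t ∷ t ∷ [])  ≡⟨ g₃ (a ℕ.+ t) (c ℕ.+ t) t ⟩
  + 2 * (+ (a ℕ.+ t) - + t)       ≡⟨ cong (λ p → + 2 * (p - + t)) (ℤP.pos-+ a t) ⟩
  + 2 * (+ a + + t - + t)         ≡⟨ cancel (+ a) (+ t) ⟩
  + 2 * + a                       ≡⟨ sym (ℤP.pos-* 2 a) ⟩
  + (2 ℕ.* a)                     ∎
  where
  cancel : ∀ p r → + 2 * (p + r - r) ≡ + 2 * p
  cancel = solve-∀

admissible-lift : ∀ {a c} t → c ≤ a → a ≤ 2 → admissible 4 (a ℕ.+ t ∷ c ℕ.+ t ∷ t ∷ []) ≡ true
admissible-lift {a} {c} t c≤a a≤2 = cong₂ _∧_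
  (cong₂ _∧_ (⌊⌋-true (c ℕ.+ t ℕP.≤? a ℕ.+ t) (ℕP.+-monoˡ-≤ t c≤a))
             (cong (_∧ true) (⌊⌋-true (t ℕP.≤? c ℕ.+ t) (ℕP.m≤n+m t c))))
  (trans (cong (λ h → ⌊ h ℤ.≤? + 4 ⌋) (g-lift a c t))
         (⌊⌋-true (+ (2 ℕ.* a) ℤ.≤? + 4) (+≤+ (ℕP.*-monoʳ-≤ 2 a≤2))))

admissible-tall : ∀ c t → admissible 4 (3 ℕ.+ t ∷ c ℕ.+ t ∷ t ∷ []) ≡ false
admissible-tall c t = trans (cong (λ h → sorted ∧ ⌊ h ℤ.≤? + 4 ⌋) (g-lift 3 c t)) (∧-zeroʳ sorted)
  where
  sorted : Bool
  sorted = decreasing (3 ℕ.+ t ∷ c ℕ.+ t ∷ t ∷ [])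

admissible-unsorted₁₂ : ∀ {u x₁ x₂ x₃} → x₁ < x₂ → admissible u (x₁ ∷ x₂ ∷ x₃ ∷ []) ≡ false
admissible-unsorted₁₂ {u} {x₁} {x₂} {x₃} x₁<x₂ =
  cong (λ c → (c ∧ decreasing (x₂ ∷ x₃ ∷ [])) ∧ ⌊ g (x₁ ∷ x₂ ∷ x₃ ∷ []) ℤ.≤? + u ⌋)
       (⌊⌋-false (x₂ ℕP.≤? x₁) (ℕP.<⇒≱ x₁<x₂))

admissible-unsorted₂₃ : ∀ {u x₁ x₂ x₃} → x₂ < x₃ → admissible u (x₁ ∷ x₂ ∷ x₃ ∷ []) ≡ false
admissible-unsorted₂₃ {u} {x₁} {x₂} {x₃} x₂<x₃ =
  trans (cong (λ c → (x₂≤x₁ ∧ (c ∧ true)) ∧ height≤u) (⌊⌋-false (x₃ ℕP.≤? x₂) (ℕP.<⇒≱ x₂<x₃)))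
        (cong (_∧ height≤u) (∧-zeroʳ x₂≤x₁))
  where
  x₂≤x₁ height≤u : Bool
  x₂≤x₁ = ⌊ x₂ ℕP.≤? x₁ ⌋
  height≤u = ⌊ g (x₁ ∷ x₂ ∷ x₃ ∷ []) ℤ.≤? + u ⌋

admissible-shape : ∀ s t → admissible 4 (shape s t) ≡ true
admissible-shape s00 t = admissible-lift t z≤n z≤n
admissible-shape s10 t = admissible-lift t z≤n (s≤s z≤n)
admissible-shape s11 t = admissible-lift t (s≤s z≤n) (s≤s z≤n)
admissible-shape s20 t = admissible-lift t z≤n (s≤s (s≤s z≤n))
admissible-shape s21 t = admissible-lift t (s≤s z≤n) (s≤s (s≤s z≤n))
admissible-shape s22 t = admissible-lift t (s≤s (s≤s z≤n)) (s≤s (s≤s z≤n))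

HasShape : Point 3 → Maybe Shape → Set
HasShape y (just s) = ∃[ t ] y ≡ shape s t
HasShape y nothing  = admissible 4 y ≡ false

step-shape : ∀ s σ t → HasShape (step (shape s t) σ) (move s σ)
step-shape s00 e₁ t = t , refl
step-shape s00 e₂ t = admissible-unsorted₁₂ (ℕP.n<1+n t)
step-shape s00 e₃ t = admissible-unsorted₂₃ (ℕP.n<1+n t)
step-shape s10 e₁ t = t , refl
step-shape s10 e₂ t = t , refl
step-shape s10 e₃ t = admissible-unsorted₂₃ (ℕP.n<1+n t)
step-shape s11 e₁ t = t , refl
step-shape s11 e₂ t = admissible-unsorted₁₂ (ℕP.n<1+n (suc t))
step-shape s11 e₃ t = suc t , refl
step-shape s20 e₁ t = admissible-tall 0 t
step-shape s20 e₂ t = t , refl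
step-shape s20 e₃ t = admissible-unsorted₂₃ (ℕP.n<1+n t)
step-shape s21 e₁ t = admissible-tall 1 t
step-shape s21 e₂ t = t , refl
step-shape s21 e₃ t = suc t , refl
step-shape s22 e₁ t = admissible-tall 2 t
step-shape s22 e₂ t = admissible-unsorted₁₂ (ℕP.n<1+n (suc (suc t)))
step-shape s22 e₃ t = suc t , refl

allEq-diagonal : ∀ n → allEq n (n ∷ n ∷ n ∷ []) ≡ true
allEq-diagonal n rewrite ⌊⌋-true (n ℕ.≟ n) refl = refl

allEq-unequal₁₃ : ∀ n x₁ x₂ x₃ → x₁ ≢ x₃ → allEq n (x₁ ∷ x₂ ∷ x₃ ∷ []) ≡ false
allEq-unequal₁₃ n x₁ x₂ x₃ x₁≢x₃ with x₁ ℕ.≟ n | x₃ ℕ.≟ n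
... | yes refl | yes refl = ⊥-elim (x₁≢x₃ refl)
... | yes _    | no _     = ∧-zeroʳ _
... | no _     | _        = refl

module ShapeCount (b : ℕ → ℤ) (n : ℕ) where
  open PathSum b 3 4 n
  open Transfer (b 0) (b 2) (b 4)

  upWeight-shape : ∀ s σ t → upWeight b (shape s t) σ ≡ weight s σ
  upWeight-shape s e₁ t = trans (cong (λ h → b ∣ h ∣) (g-lift (top s) (mid s) t)) (level-top s)
    where
    level-top : ∀ s → b (2 ℕ.* top s) ≡ level s
    level-top s00 = refl
    level-top s10 = refl
    level-top s11 = refl
    level-top s20 = refl
    level-top s21 = refl
    level-top s22 = refl
  upWeight-shape s e₂ t = refl
  upWeight-shape s e₃ t = refl

  pathSum-end : ∀ s t → V.sum (shape s t) ≡ 3 ℕ.* n → pathSum (shape s t) 0 ≡ E 0 s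
  pathSum-end s t h =
    trans (cong (λ c → if c ∧ allEq n (toList (shape s t)) then + 1 else +0) (admissible-shape s t)) (ends s t h)
    where
    apart : ∀ a t → suc a ℕ.+ t ≢ t
    apart a t eq = ℕP.m≢1+n+m t (sym eq)
    off-diagonal : ∀ s t → top s ℕ.+ t ≢ t → (if allEq n (toList (shape s t)) then + 1 else +0) ≡ +0
    off-diagonal s t ne = cong (if_then + 1 else +0) (allEq-unequal₁₃ n (top s ℕ.+ t) (mid s ℕ.+ t) t ne)
    ends : ∀ s t → V.sum (shape s t) ≡ 3 ℕ.* n → (if allEq n (toList (shape s t)) then + 1 else +0) ≡ E 0 s
    ends s00 t h with ℕP.*-cancelˡ-≡ t n 3 h
    ... | refl = cong (if_then + 1 else +0) (allEq-diagonal t)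
    ends s10 t _ = off-diagonal s10 t (apart 0 t)
    ends s11 t _ = off-diagonal s11 t (apart 0 t)
    ends s20 t _ = off-diagonal s20 t (apart 1 t)
    ends s21 t _ = off-diagonal s21 t (apart 1 t)
    ends s22 t _ = off-diagonal s22 t (apart 1 t)

  pathSum-shape : ∀ m s t → V.sum (shape s t) ℕ.+ m ≡ 3 ℕ.* n → pathSum (shape s t) m ≡ E m s
  pathSum-shape zero    s t h = pathSum-end s t (trans (sym (ℕP.+-identityʳ _)) h)
  pathSum-shape (suc m) s t h = begin
    pathSum (shape s t) (suc m)
      ≡⟨ pathSum-suc {shape s t} m (admissible-shape s t) ⟩
    sumℤ (map (λ σ → upWeight b (shape s t) σ * pathSum (step (shape s t) σ) m) (allFin 3))
      ≡⟨ sumℤ-map-cong (λ σ → cong₂ _*_ (upWeight-shape s σ t) (after σ (move s σ) (step-shape s σ t))) (allFin 3) ⟩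
    E (suc m) s ∎
    where
    after : ∀ σ r → HasShape (step (shape s t) σ) r → pathSum (step (shape s t) σ) m ≡ follow (E m) r
    after σ nothing     dead          = pathSum-inadmissible m dead
    after σ (just s′) (t′ , reached) = trans (cong (λ y → pathSum y m) reached) (pathSum-shape m s′ t′ size)
      where
      size : V.sum (shape s′ t′) ℕ.+ m ≡ 3 ℕ.* n
      size = begin
        V.sum (shape s′ t′) ℕ.+ m            ≡⟨ cong (λ y → V.sum y ℕ.+ m) (sym reached) ⟩
        V.sum (step (shape s t) σ) ℕ.+ m     ≡⟨ cong (ℕ._+ m) (sum-step (shape s t) σ) ⟩
        suc (V.sum (shape s t)) ℕ.+ m        ≡⟨ sym (ℕP.+-suc _ m) ⟩
        V.sum (shape s t) ℕ.+ suc m          ≡⟨ h ⟩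
        3 ℕ.* n                              ∎

Chat₃₄≡E : ∀ (b : ℕ → ℤ) n → Chat b 3 4 n ≡ Transfer.E (b 0) (b 2) (b 4) (3 ℕ.* n) s00
Chat₃₄≡E b n = trans (PathSum.Chat≡pathSum b 3 4 n) (ShapeCount.pathSum-shape b n (3 ℕ.* n) s00 0 refl)

theorem4p2 : (b : ℕ → ℤ) (n : ℕ) → n ≥ 2 →
    Chat b 3 4 n ≡ (b 0 + + 3 * b 2) * Chat b 3 4 (n Data.Nat.∸ 1)
                   + b 0 * b 2 * Chat b 3 4 (n Data.Nat.∸ 2)
theorem4p2 b zero          ()
theorem4p2 b (suc zero)    (s≤s ())
theorem4p2 b (suc (suc n)) _ = begin
  Chat b 3 4 (2 ℕ.+ n)                                 ≡⟨ Chat₃₄≡E b (2 ℕ.+ n) ⟩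
  E (3 ℕ.* (2 ℕ.+ n)) s00                              ≡⟨ E-recurrence n ⟩
  α * E (3 ℕ.* (1 ℕ.+ n)) s00 + β * E (3 ℕ.* n) s00
    ≡⟨ sym (cong₂ (λ p q → α * p + β * q) (Chat₃₄≡E b (1 ℕ.+ n)) (Chat₃₄≡E b n)) ⟩
  α * Chat b 3 4 (1 ℕ.+ n) + β * Chat b 3 4 n          ∎
  where
  open Transfer (b 0) (b 2) (b 4)
  α β : ℤ
  α = b 0 + + 3 * b 2
  β = b 0 * b 2
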